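{- For any $1\le i\le m-1$, $P_i(m)=|\Sigma_{i+1}|\cdot|\Sigma|^{m-(i+1)}$. Moreover, $P_m(m)=1$.
   Context: Let $\Sigma$ be a finite totally ordered alphabet with $|\Sigma|=2^b$; each letter is identified bijectively with a $b$-bit vector and $a\oplus a'$ is the letter whose bit vector is the componentwise XOR. For equal-length words, $\oplus$ acts letterwise; equal-length words are compared lexicographically. An $m$-mer of a word is a contiguous factor of length $m$. Fix integers $1\le m<k$, a word $w=a_1\cdots a_m\in\Sigma^m$ and a key $\gamma=c_1\cdots c_m\in\Sigma^m$. Specialized alphabets: for $1\le i\le m$, $\Sigma_i=\{a\in\Sigma: a\oplus c_i>a_i\oplus c_i\}$. A word $z$ is a postmer if every $m$-mer $w'$ of $z$ satisfies $w'\oplus\gamma\ge w\oplus\gamma$. $P_i(\beta)$ is the number of postmers of length $\beta$ whose longest common prefix with $w$ has length exactly $i$. -}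

module Defs where

open import Data.Nat using (ℕ; zero; suc; _^_; _<ᵇ_; _≡ᵇ_; _≤ᵇ_)
open import Data.Bool using (Bool; true; false; if_then_else_; _∧_; not; _xor_)
open import Data.Fin using (Fin; toℕ)
open import Data.Vec using (Vec; zipWith)
open import Data.List using (List; []; _∷_; length; take; map; concatMap; allFin; filterᵇ)
open import Function.Bundles using (_↔_; Inverse)

-- The alphabet Σ: a finite totally ordered set of size 2^b, taken (up to
-- order-isomorphism) to be Fin (2 ^ b) with its natural order.
Letter : ℕ → Set
Letter b = Fin (2 ^ b)

Coding : ℕ → Set
Coding b = Letter b ↔ Vec Bool b

xorL : ∀ {b} → Coding b → Letter b → Letter b → Letter b
xorL enc a a' = Inverse.from enc (zipWith _xor_ (Inverse.to enc a) (Inverse.to enc a'))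

xorW : ∀ {b} → Coding b → List (Letter b) → List (Letter b) → List (Letter b)
xorW enc (x ∷ xs) (y ∷ ys) = xorL enc x y ∷ xorW enc xs ys
xorW enc _ _ = []

ltL : ∀ {n} → Fin n → Fin n → Bool
ltL x y = toℕ x <ᵇ toℕ y

lexLeq : ∀ {n} → List (Fin n) → List (Fin n) → Bool
lexLeq [] _ = true
lexLeq (x ∷ xs) [] = false
lexLeq (x ∷ xs) (y ∷ ys) =
  if toℕ x <ᵇ toℕ y then true
  else (if toℕ x ≡ᵇ toℕ y then lexLeq xs ys else false)

allᵇ : ∀ {A : Set} → (A → Bool) → List A → Bool
allᵇ p [] = true
allᵇ p (x ∷ xs) = p x ∧ allᵇ p xs

mmers : ∀ {A : Set} → ℕ → List A → List (List A)
mmers m [] = if m ≡ᵇ 0 then [] ∷ [] else []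
mmers m (x ∷ xs) =
  if m ≤ᵇ length (x ∷ xs) then take m (x ∷ xs) ∷ mmers m xs else []

isPostmer : ∀ {b} → Coding b → (m : ℕ) → (w γ z : List (Letter b)) → Bool
isPostmer enc m w γ z = allᵇ (λ w' → lexLeq (xorW enc w γ) (xorW enc w' γ)) (mmers m z)

lcp : ∀ {n} → List (Fin n) → List (Fin n) → ℕ
lcp (x ∷ xs) (y ∷ ys) = if toℕ x ≡ᵇ toℕ y then suc (lcp xs ys) else 0
lcp _ _ = 0

words : (n β : ℕ) → List (List (Fin n))
words n zero = [] ∷ []
words n (suc β) = concatMap (λ a → map (a ∷_) (words n β)) (allFin n)

P : ∀ {b} → Coding b → (m : ℕ) → (w γ : List (Letter b)) → (i β : ℕ) → ℕ
P {b} enc m w γ i β =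
  length (filterᵇ (λ z → isPostmer enc m w γ z ∧ (lcp z w ≡ᵇ i)) (words (2 ^ b) β))

-- |Σ_j| where Σ_j = { a : a ⊕ c_j > a_j ⊕ c_j }, given the letters a_j, c_j
cardSpec : ∀ {b} → Coding b → (aj cj : Letter b) → ℕ
cardSpec {b} enc aj cj =
  length (filterᵇ (λ a → ltL (xorL enc aj cj) (xorL enc a cj)) (allFin (2 ^ b)))

-- A word z of length m has exactly one m-mer, z itself, so it is a postmer iff z ⊕ γ ≥ w ⊕ γ.
-- If z and w share exactly the first i letters, the comparison of z ⊕ γ with w ⊕ γ is decided at
-- position i + 1: for i < m it holds iff z's letter there lies in Σ_{i+1}, the letters after it
-- being free, which gives |Σ_{i+1}| · |Σ|^(m-(i+1)) words; for i = m the only such word is w.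
module Submission where

open import Defs
open import Data.Bool using (Bool; true; false; if_then_else_; _∧_; _xor_; T)
open import Data.Bool.Properties using (∧-zeroʳ; ∧-identityʳ)
open import Data.Empty using (⊥-elim)
open import Data.Fin using (Fin; toℕ; fromℕ<) renaming (zero to fzero; suc to fsuc)
open import Data.Fin.Properties using (toℕ-injective)
open import Data.List using (List; []; _∷_; length; map; concatMap; allFin; filterᵇ; _++_)
open import Data.List.Properties using (map-cong; map-tabulate; length-tabulate; take-all)
open import Data.Nat using (ℕ; zero; suc; _^_; _*_; _+_; _∸_; _≤_; _<_; _<ᵇ_; _≡ᵇ_; _≤ᵇ_; s≤s)
open import Data.Nat.ListAction using (sum)
open import Data.Nat.Properties using (≡ᵇ⇒≡; ≤ᵇ⇒≤; ≤⇒≤ᵇ; ≤-refl; <⇒≱; *-identityˡ)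
open import Data.Product using (_×_; _,_)
open import Data.Vec using (Vec; []; _∷_; toList; lookup; zipWith)
open import Function.Base using (_∘′_)
open import Function.Bundles using (Inverse)
open import Relation.Binary.PropositionalEquality
  using (_≡_; refl; sym; trans; cong; cong₂; subst; module ≡-Reasoning)

open ≡-Reasoning

count : {A : Set} → (A → Bool) → List A → ℕ
count p xs = length (filterᵇ p xs)

module _ {A : Set} where

  count-++ : (p : A → Bool) (xs ys : List A) → count p (xs ++ ys) ≡ count p xs + count p ys
  count-++ p [] ys = refl
  count-++ p (x ∷ xs) ys with p x
  ... | true  = cong suc (count-++ p xs ys)
  ... | false = count-++ p xs ys

  count-map : {B : Set} (p : B → Bool) (f : A → B) (xs : List A) →
    count p (map f xs) ≡ count (λ x → p (f x)) xs
  count-map p f [] = refl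
  count-map p f (x ∷ xs) with p (f x)
  ... | true  = cong suc (count-map p f xs)
  ... | false = count-map p f xs

  count-cong : (p q : A → Bool) → (∀ x → p x ≡ q x) → (xs : List A) → count p xs ≡ count q xs
  count-cong p q p≗q [] = refl
  count-cong p q p≗q (x ∷ xs) with p x | q x | p≗q x
  ... | true  | .true  | refl = cong suc (count-cong p q p≗q xs)
  ... | false | .false | refl = count-cong p q p≗q xs

  count-none : (p : A → Bool) → (∀ x → p x ≡ false) → (xs : List A) → count p xs ≡ 0
  count-none p p≗false [] = refl
  count-none p p≗false (x ∷ xs) with p x | p≗false x
  ... | .false | refl = count-none p p≗false xs

  count-true : (xs : List A) → count (λ _ → true) xs ≡ length xs
  count-true [] = refl
  count-true (x ∷ xs) = cong suc (count-true xs)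

  count-∧ˡ : (c : Bool) (q : A → Bool) (xs : List A) →
    count (λ x → c ∧ q x) xs ≡ (if c then count q xs else 0)
  count-∧ˡ true  q xs = refl
  count-∧ˡ false q xs = count-none _ (λ _ → refl) xs

  sum-map-if : (p : A → Bool) (K : ℕ) (xs : List A) →
    sum (map (λ x → if p x then K else 0) xs) ≡ count p xs * K
  sum-map-if p K [] = refl
  sum-map-if p K (x ∷ xs) with p x
  ... | true  = cong (K +_) (sum-map-if p K xs)
  ... | false = sum-map-if p K xs

module _ {N : ℕ} where

  count-concatMap-cons : (f : List (Fin N) → Bool) (W : List (List (Fin N))) (L : List (Fin N)) →
    count f (concatMap (λ a → map (a ∷_) W) L) ≡ sum (map (λ a → count (λ zs → f (a ∷ zs)) W) L)
  count-concatMap-cons f W [] = refl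
  count-concatMap-cons f W (a ∷ L) = begin
    count f (map (a ∷_) W ++ concatMap (λ a → map (a ∷_) W) L)
      ≡⟨ count-++ f (map (a ∷_) W) _ ⟩
    count f (map (a ∷_) W) + count f (concatMap (λ a → map (a ∷_) W) L)
      ≡⟨ cong₂ _+_ (count-map f (a ∷_) W) (count-concatMap-cons f W L) ⟩
    count (λ zs → f (a ∷ zs)) W + sum (map (λ a → count (λ zs → f (a ∷ zs)) W) L) ∎

  count-words-suc : ∀ n (f : List (Fin N) → Bool) →
    count f (words N (suc n)) ≡ sum (map (λ a → count (λ zs → f (a ∷ zs)) (words N n)) (allFin N))
  count-words-suc n f = count-concatMap-cons f (words N n) (allFin N)

  count-words-cong : ∀ n (f g : List (Fin N) → Bool) → (∀ z → length z ≡ n → f z ≡ g z) →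
    count f (words N n) ≡ count g (words N n)
  count-words-cong zero f g f≗g with f [] | g [] | f≗g [] refl
  ... | true  | .true  | refl = refl
  ... | false | .false | refl = refl
  count-words-cong (suc n) f g f≗g = begin
    count f (words N (suc n))
      ≡⟨ count-words-suc n f ⟩
    sum (map (λ a → count (λ zs → f (a ∷ zs)) (words N n)) (allFin N))
      ≡⟨ cong sum (map-cong (λ a → count-words-cong n _ _ (λ z ∣z∣≡n → f≗g (a ∷ z) (cong suc ∣z∣≡n)))
                            (allFin N)) ⟩
    sum (map (λ a → count (λ zs → g (a ∷ zs)) (words N n)) (allFin N))
      ≡⟨ count-words-suc n g ⟨
    count g (words N (suc n)) ∎

  count-words-suc-∧ : ∀ n (f : List (Fin N) → Bool) (p : Fin N → Bool) (q : List (Fin N) → Bool) →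
    (∀ a zs → f (a ∷ zs) ≡ p a ∧ q zs) →
    count f (words N (suc n)) ≡ count p (allFin N) * count q (words N n)
  count-words-suc-∧ n f p q f≡p∧q = begin
    count f (words N (suc n))
      ≡⟨ count-words-suc n f ⟩
    sum (map (λ a → count (λ zs → f (a ∷ zs)) (words N n)) (allFin N))
      ≡⟨ cong sum (map-cong (λ a → trans (count-cong _ _ (f≡p∧q a) (words N n))
                                         (count-∧ˡ (p a) q (words N n)))
                            (allFin N)) ⟩
    sum (map (λ a → if p a then count q (words N n) else 0) (allFin N))
      ≡⟨ sum-map-if p _ (allFin N) ⟩
    count p (allFin N) * count q (words N n) ∎

  length-words : ∀ n → length (words N n) ≡ N ^ n
  length-words zero = refl
  length-words (suc n) = begin
    length (words N (suc n))
      ≡⟨ count-true (words N (suc n)) ⟨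
    count (λ _ → true) (words N (suc n))
      ≡⟨ count-words-suc-∧ n _ (λ _ → true) (λ _ → true) (λ _ _ → refl) ⟩
    count (λ _ → true) (allFin N) * count (λ _ → true) (words N n)
      ≡⟨ cong₂ _*_ (trans (count-true (allFin N)) (length-tabulate {n = N} (λ a → a)))
                   (trans (count-true (words N n)) (length-words n)) ⟩
    N * N ^ n ∎

allFin-suc : ∀ N → allFin (suc N) ≡ fzero ∷ map fsuc (allFin N)
allFin-suc N = cong (fzero ∷_) (sym (map-tabulate (λ a → a) fsuc))

count-toℕ-≡ᵇ : ∀ {N} (x : Fin N) → count (λ a → toℕ a ≡ᵇ toℕ x) (allFin N) ≡ 1
count-toℕ-≡ᵇ {suc N} x = trans (cong (count (λ a → toℕ a ≡ᵇ toℕ x)) (allFin-suc N)) (count-cons x)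
  where
  count-cons : (x : Fin (suc N)) → count (λ a → toℕ a ≡ᵇ toℕ x) (fzero ∷ map fsuc (allFin N)) ≡ 1
  count-cons fzero    = cong suc (trans (count-map _ fsuc (allFin N)) (count-none _ (λ _ → refl) (allFin N)))
  count-cons (fsuc y) = trans (count-map _ fsuc (allFin N)) (count-toℕ-≡ᵇ y)

xor-cancelʳ : ∀ x c → (x xor c) xor c ≡ x
xor-cancelʳ true  true  = refl
xor-cancelʳ true  false = refl
xor-cancelʳ false true  = refl
xor-cancelʳ false false = refl

zipWith-xor-cancelʳ : ∀ {n} (u c : Vec Bool n) → zipWith _xor_ (zipWith _xor_ u c) c ≡ u
zipWith-xor-cancelʳ [] [] = refl
zipWith-xor-cancelʳ (x ∷ u) (c ∷ cs) = cong₂ _∷_ (xor-cancelʳ x c) (zipWith-xor-cancelʳ u cs)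

xorL-injectiveˡ : ∀ {b} (enc : Coding b) {a x c : Letter b} → xorL enc a c ≡ xorL enc x c → a ≡ x
xorL-injectiveˡ {b} enc {a} {x} {c} a⊕c≡x⊕c = begin
  a                            ≡⟨ strictlyInverseʳ a ⟨
  from (to a)                  ≡⟨ cong from (sym (recover a)) ⟩
  from (unmask (xorL enc a c)) ≡⟨ cong (from ∘′ unmask) a⊕c≡x⊕c ⟩
  from (unmask (xorL enc x c)) ≡⟨ cong from (recover x) ⟩
  from (to x)                  ≡⟨ strictlyInverseʳ x ⟩
  x                            ∎
  where
  open Inverse enc
  unmask : Letter b → Vec Bool b
  unmask y = zipWith _xor_ (to y) (to c)
  recover : (y : Letter b) → unmask (xorL enc y c) ≡ to y
  recover y = trans (cong (λ v → zipWith _xor_ v (to c)) (strictlyInverseˡ _)) (zipWith-xor-cancelʳ (to y) (to c))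

<ᵇ-irrefl : ∀ n → (n <ᵇ n) ≡ false
<ᵇ-irrefl zero    = refl
<ᵇ-irrefl (suc n) = <ᵇ-irrefl n

≡ᵇ-refl : ∀ n → (n ≡ᵇ n) ≡ true
≡ᵇ-refl zero    = refl
≡ᵇ-refl (suc n) = ≡ᵇ-refl n

toℕ-≡ᵇ⇒≡ : ∀ {N} (a x : Fin N) → (toℕ a ≡ᵇ toℕ x) ≡ true → a ≡ x
toℕ-≡ᵇ⇒≡ a x eq = toℕ-injective (≡ᵇ⇒≡ (toℕ a) (toℕ x) (subst T (sym eq) _))

mmers-short : ∀ {A : Set} m (ys : List A) → length ys < m → mmers m ys ≡ []
mmers-short (suc m) [] _ = refl
mmers-short m (y ∷ ys) ∣ys∣<m with m ≤ᵇ length (y ∷ ys) in m≤∣ys∣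
... | false = refl
... | true  = ⊥-elim (<⇒≱ ∣ys∣<m (≤ᵇ⇒≤ m _ (subst T (sym m≤∣ys∣) _)))

mmers-self : ∀ {A : Set} (y : A) (ys : List A) → mmers (length (y ∷ ys)) (y ∷ ys) ≡ (y ∷ ys) ∷ []
mmers-self y ys with suc (length ys) ≤ᵇ suc (length ys) in ≤-self
... | true  = cong₂ _∷_ (take-all _ (y ∷ ys) ≤-refl) (mmers-short _ ys ≤-refl)
... | false = ⊥-elim (subst T ≤-self (≤⇒≤ᵇ (≤-refl {suc (length ys)})))

aboveWithLcp : ∀ {b} → Coding b → (w γ : List (Letter b)) → ℕ → List (Letter b) → Bool
aboveWithLcp enc w γ i z = lexLeq (xorW enc w γ) (xorW enc z γ) ∧ (lcp z w ≡ᵇ i)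

module _ {b : ℕ} (enc : Coding b) where

  isPostmer-full-length : ∀ m (w γ z : List (Letter b)) → 1 ≤ m → length z ≡ m →
    isPostmer enc m w γ z ≡ lexLeq (xorW enc w γ) (xorW enc z γ)
  isPostmer-full-length .0 w γ [] () refl
  isPostmer-full-length m w γ (y ∷ ys) _ refl rewrite mmers-self y ys = ∧-identityʳ _

  P≡count-aboveWithLcp : ∀ m (w γ : List (Letter b)) i → 1 ≤ m →
    P enc m w γ i m ≡ count (aboveWithLcp enc w γ i) (words (2 ^ b) m)
  P≡count-aboveWithLcp m w γ i 1≤m = count-words-cong m _ _ λ z ∣z∣≡m →
    cong (_∧ (lcp z w ≡ᵇ i)) (isPostmer-full-length m w γ z 1≤m ∣z∣≡m)

  aboveWithLcp-zero : ∀ (x c : Letter b) ws cs (a : Letter b) zs →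
    aboveWithLcp enc (x ∷ ws) (c ∷ cs) 0 (a ∷ zs) ≡ ltL (xorL enc x c) (xorL enc a c) ∧ true
  -- a ⊕ c > x ⊕ c forces a ≠ x, while a ⊕ c = x ⊕ c forces a = x and hence a positive lcp.
  aboveWithLcp-zero x c ws cs a zs with toℕ (xorL enc x c) <ᵇ toℕ (xorL enc a c) in x⊕c<a⊕c
  ... | true with toℕ a ≡ᵇ toℕ x in a≡x
  ...   | false = refl
  ...   | true with toℕ-≡ᵇ⇒≡ a x a≡x
  ...     | refl with trans (sym x⊕c<a⊕c) (<ᵇ-irrefl (toℕ (xorL enc x c)))
  ...       | ()
  aboveWithLcp-zero x c ws cs a zs | false with toℕ (xorL enc x c) ≡ᵇ toℕ (xorL enc a c) in x⊕c≡a⊕c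
  ...   | false = refl
  ...   | true with xorL-injectiveˡ enc (toℕ-≡ᵇ⇒≡ _ _ x⊕c≡a⊕c)
  ...     | refl rewrite ≡ᵇ-refl (toℕ x) = ∧-zeroʳ _

  aboveWithLcp-suc : ∀ i (x c : Letter b) ws cs (a : Letter b) zs →
    aboveWithLcp enc (x ∷ ws) (c ∷ cs) (suc i) (a ∷ zs) ≡ (toℕ a ≡ᵇ toℕ x) ∧ aboveWithLcp enc ws cs i zs
  aboveWithLcp-suc i x c ws cs a zs with toℕ a ≡ᵇ toℕ x in a≡x
  ... | false = ∧-zeroʳ _
  ... | true with toℕ-≡ᵇ⇒≡ a x a≡x
  ...   | refl rewrite <ᵇ-irrefl (toℕ (xorL enc a c)) | ≡ᵇ-refl (toℕ (xorL enc a c)) = refl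

  count-aboveWithLcp-zero : ∀ n (x c : Letter b) ws cs →
    count (aboveWithLcp enc (x ∷ ws) (c ∷ cs) 0) (words (2 ^ b) (suc n)) ≡ cardSpec enc x c * (2 ^ b) ^ n
  count-aboveWithLcp-zero n x c ws cs = begin
    count (aboveWithLcp enc (x ∷ ws) (c ∷ cs) 0) (words (2 ^ b) (suc n))
      ≡⟨ count-words-suc-∧ n _ _ (λ _ → true) (aboveWithLcp-zero x c ws cs) ⟩
    cardSpec enc x c * count (λ _ → true) (words (2 ^ b) n)
      ≡⟨ cong (cardSpec enc x c *_) (trans (count-true (words (2 ^ b) n)) (length-words n)) ⟩
    cardSpec enc x c * (2 ^ b) ^ n ∎

  count-aboveWithLcp-suc : ∀ n i (x c : Letter b) ws cs →
    count (aboveWithLcp enc (x ∷ ws) (c ∷ cs) (suc i)) (words (2 ^ b) (suc n))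
      ≡ count (aboveWithLcp enc ws cs i) (words (2 ^ b) n)
  count-aboveWithLcp-suc n i x c ws cs = begin
    count (aboveWithLcp enc (x ∷ ws) (c ∷ cs) (suc i)) (words (2 ^ b) (suc n))
      ≡⟨ count-words-suc-∧ n _ _ _ (aboveWithLcp-suc i x c ws cs) ⟩
    count (λ a → toℕ a ≡ᵇ toℕ x) (allFin (2 ^ b)) * count (aboveWithLcp enc ws cs i) (words (2 ^ b) n)
      ≡⟨ cong (_* _) (count-toℕ-≡ᵇ x) ⟩
    1 * count (aboveWithLcp enc ws cs i) (words (2 ^ b) n)
      ≡⟨ *-identityˡ _ ⟩
    count (aboveWithLcp enc ws cs i) (words (2 ^ b) n) ∎

  count-aboveWithLcp-< : ∀ n (w γ : Vec (Letter b) n) i (i<n : i < n) →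
    count (aboveWithLcp enc (toList w) (toList γ) i) (words (2 ^ b) n)
      ≡ cardSpec enc (lookup w (fromℕ< i<n)) (lookup γ (fromℕ< i<n)) * (2 ^ b) ^ (n ∸ (i + 1))
  count-aboveWithLcp-< (suc n) (x ∷ w) (c ∷ γ) zero    _         = count-aboveWithLcp-zero n x c (toList w) (toList γ)
  count-aboveWithLcp-< (suc n) (x ∷ w) (c ∷ γ) (suc i) (s≤s i<n) =
    trans (count-aboveWithLcp-suc n i x c (toList w) (toList γ)) (count-aboveWithLcp-< n w γ i i<n)

  count-aboveWithLcp-full : ∀ n (w γ : Vec (Letter b) n) →
    count (aboveWithLcp enc (toList w) (toList γ) n) (words (2 ^ b) n) ≡ 1
  count-aboveWithLcp-full zero    []      []      = refl
  count-aboveWithLcp-full (suc n) (x ∷ w) (c ∷ γ) =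
    trans (count-aboveWithLcp-suc n n x c (toList w) (toList γ)) (count-aboveWithLcp-full n w γ)

-- lookup at index i is the paper's letter number i + 1.
lemma6 : (b m k : ℕ) (enc : Coding b) → 1 ≤ m → m < k →
    (w γ : Vec (Letter b) m) →
    ((i : ℕ) → 1 ≤ i → (i<m : i < m) →
      P enc m (toList w) (toList γ) i m
        ≡ cardSpec enc (lookup w (fromℕ< i<m)) (lookup γ (fromℕ< i<m)) * (2 ^ b) ^ (m ∸ (i + 1)))
    × (P enc m (toList w) (toList γ) m m ≡ 1)
lemma6 b m k enc 1≤m _ w γ =
  (λ i _ i<m → trans (P≡count-aboveWithLcp enc m (toList w) (toList γ) i 1≤m)
                     (count-aboveWithLcp-< enc m w γ i i<m))
  , trans (P≡count-aboveWithLcp enc m (toList w) (toList γ) m 1≤m) (count-aboveWithLcp-full enc m w γ)
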